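{- Let $\rho=(r,U)$ be a universally quantified rule and let $f:U\to\mathbb{N}_0$ be any function. Any two instantiations of $\rho$ generated by a sequence of instantiation steps that uses each $u\in U$ exactly $f(u)$ times (in any order) are the same up to isomorphism: if $(\pi_1:L\to\bar L_1,\gamma_1:\bar L_1\rightharpoonup\bar R_1)$ and $(\pi_2:L\to\bar L_2,\gamma_2:\bar L_2\rightharpoonup\bar R_2)$ are two such instantiations, there are isomorphisms $\alpha:\bar L_1\to\bar L_2$ and $\beta:\bar R_1\to\bar R_2$ with $\alpha\circ\pi_1=\pi_2$ and $\beta\circ\gamma_1=\gamma_2\circ\alpha$.
   Context: A graph is $G=(V_G,E_G,c_G,l_G)$ over a finite label set $\Lambda$ with arity $\mathrm{ar}$: finite $V_G,E_G$, $c_G:E_G\to V_G^*$, $l_G:E_G\to\Lambda$, $|c_G(e)|=\mathrm{ar}(l_G(e))$; $e$ is incident to $v$ if $v$ occurs in $c_G(e)$. A morphism $\varphi:G\rightharpoonup G'$ is a pair of partial functions on nodes and edges such that whenever $\varphi_E(e)$ is defined, $\varphi_V$ is defined on all nodes of $c_G(e)$, labels are preserved and $\varphi_V(c_G(e))=c_{G'}(\varphi_E(e))$; total/injective if both components are. Pushout of $\varphi:G_0\rightharpoonup G_1,\psi:G_0\rightharpoonup G_2$ in the category of graphs and partial morphisms: $G_3$ with $\psi':G_1\rightharpoonup G_3$, $\varphi':G_2\rightharpoonup G_3$, $\psi'\circ\varphi=\varphi'\circ\psi$, universal among such commuting pairs (unique up to isomorphism). Universally quantified rule $\rho=(r,U)$: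 $r:L\rightharpoonup R$, $U$ a finite set of $u=(p_u,q_u)$, $p_u:L\to L_u$ total injective, $q_u:L_u\rightharpoonup R_u$, with $q_u(p_u(x))$ defined and having exactly one $q_u$-preimage for each element $x$ of $L$; the set of nodes $v\in V_L$ such that some edge incident to $p_u(v)$ has no $p_u$-preimage is nonempty. Instantiations $(\pi:L\to\bar L,\gamma:\bar L\rightharpoonup\bar R)$: $(\mathrm{id}_L,r)$ is one (using no steps); an instantiation step from $(\pi,\gamma)$ using $u\in U$: let $(\bar L_u,p'_u,\pi')$ be the pushout of $\pi$ and $p_u$, $(\bar R_u,\sigma:\bar R\rightharpoonup\bar R_u,\tau:R_u\rightharpoonup\bar R_u)$ the pushout of $\gamma\circ\pi$ and $q_u\circ p_u$, and $\eta:\bar L_u\rightharpoonup\bar R_u$ the unique morphism with $\eta\circ p'_u=\sigma\circ\gamma$, $\eta\circ\pi'=\tau\circ q_u$; the result is $(\pi,\gamma)\oplus u:=(p'_u\circ\pi,\eta)$. -}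

module Defs where

open import Data.Nat using (ℕ; zero; suc)
open import Data.Fin using (Fin; _≟_)
open import Data.List using (List; []; _∷_; length; map)
open import Data.List.Properties using (map-∘)
open import Data.List.Membership.Propositional using (_∈_)
open import Data.Maybe using (Maybe; just; nothing)
open import Data.Product using (Σ; _×_; _,_; proj₁; proj₂)
open import Relation.Nullary using (¬_; yes; no)
open import Relation.Binary.PropositionalEquality
  using (_≡_; _≢_; refl; sym; trans; cong)

record Signature : Set where
  field
    nΛ : ℕ
    ar : Fin nΛ → ℕ

record Graph (S : Signature) : Set where
  open Signature S
  field
    nV    : ℕ
    nE    : ℕ
    lab   : Fin nE → Fin nΛ
    att   : Fin nE → List (Fin nV)
    arity : ∀ e → length (att e) ≡ ar (lab e)

open Graph public

bind : {A B : Set} → Maybe A → (A → Maybe B) → Maybe B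
bind nothing  _ = nothing
bind (just a) g = g a

-- Partial morphisms.  If φ_E(e) = e' then φ_V is defined on all
-- attachment nodes of e, labels are preserved and
-- φ_V(c_G(e)) = c_{G'}(e')  (expressed as map φ_V (c e) ≡ map just (c' e')).

module _ {S : Signature} where

  record Morph (G H : Graph S) : Set where
    field
      mV : Fin (nV G) → Maybe (Fin (nV H))
      mE : Fin (nE G) → Maybe (Fin (nE H))
      ok : ∀ e e' → mE e ≡ just e' →
           (lab H e' ≡ lab G e) × (map mV (att G e) ≡ map just (att H e'))

  open Morph public

  idM : (G : Graph S) → Morph G G
  idM G = record { mV = just ; mE = just ; ok = λ { e .e refl → refl , refl } }

  _⊚_ : {G H K : Graph S} → Morph H K → Morph G H → Morph G K
  _⊚_ {G} {H} {K} g f = record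
    { mV = λ v → bind (mV f v) (mV g)
    ; mE = λ e → bind (mE f e) (mE g)
    ; ok = okc }
    where
    okc : ∀ e e'' → bind (mE f e) (mE g) ≡ just e'' →
          (lab K e'' ≡ lab G e) ×
          (map (λ v → bind (mV f v) (mV g)) (att G e) ≡ map just (att K e''))
    okc e e'' eq with mE f e in eq1
    ... | just e' =
      trans (proj₁ (ok g e' e'' eq)) (proj₁ (ok f e e' eq1)) ,
      trans (map-∘ (att G e))
        (trans (cong (map (λ x → bind x (mV g))) (proj₂ (ok f e e' eq1)))
          (trans (sym (map-∘ (att H e'))) (proj₂ (ok g e' e'' eq))))

  infixr 9 _⊚_

  _≈_ : {G H : Graph S} → Morph G H → Morph G H → Set
  f ≈ g = (∀ v → mV f v ≡ mV g v) × (∀ e → mE f e ≡ mE g e)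

  Total : {G H : Graph S} → Morph G H → Set
  Total {G} {H} f = (∀ v → Σ (Fin (nV H)) λ w → mV f v ≡ just w)
                  × (∀ e → Σ (Fin (nE H)) λ e' → mE f e ≡ just e')

  Injective : {G H : Graph S} → Morph G H → Set
  Injective {G} {H} f =
      (∀ v v' w → mV f v ≡ just w → mV f v' ≡ just w → v ≡ v')
    × (∀ e e' d → mE f e ≡ just d → mE f e' ≡ just d → e ≡ e')

  IsIso : {G H : Graph S} → Morph G H → Set
  IsIso {G} {H} α = Σ (Morph H G) λ α⁻ → ((α⁻ ⊚ α) ≈ idM G) × ((α ⊚ α⁻) ≈ idM H)

  record IsPushout {G0 G1 G2 G3 : Graph S}
                   (φ : Morph G0 G1) (ψ : Morph G0 G2)
                   (ψ' : Morph G1 G3) (φ' : Morph G2 G3) : Set where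
    field
      commute   : (ψ' ⊚ φ) ≈ (φ' ⊚ ψ)
      universal : ∀ (H : Graph S) (χ₁ : Morph G1 H) (χ₂ : Morph G2 H) →
                  (χ₁ ⊚ φ) ≈ (χ₂ ⊚ ψ) →
                  Σ (Morph G3 H) λ θ →
                    ((θ ⊚ ψ') ≈ χ₁) × ((θ ⊚ φ') ≈ χ₂) ×
                    (∀ (θ' : Morph G3 H) → (θ' ⊚ ψ') ≈ χ₁ → (θ' ⊚ φ') ≈ χ₂ → θ' ≈ θ)

record UQRule (S : Signature) : Set₁ where
  field
    L R   : Graph S
    r     : Morph L R
    m     : ℕ                               -- U is indexed by Fin m
    Lu Ru : Fin m → Graph S
    p     : (u : Fin m) → Morph L (Lu u)
    q     : (u : Fin m) → Morph (Lu u) (Ru u)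
    p-total : ∀ u → Total (p u)
    p-inj   : ∀ u → Injective (p u)
    q-nodes : ∀ u (v : Fin (nV L)) → Σ (Fin (nV (Lu u))) λ w → mV (p u) v ≡ just w ×
                Σ (Fin (nV (Ru u))) λ y → mV (q u) w ≡ just y ×
                  (∀ z → mV (q u) z ≡ just y → z ≡ w)
    q-edges : ∀ u (e : Fin (nE L)) → Σ (Fin (nE (Lu u))) λ w → mE (p u) e ≡ just w ×
                Σ (Fin (nE (Ru u))) λ y → mE (q u) w ≡ just y ×
                  (∀ z → mE (q u) z ≡ just y → z ≡ w)
    nonempty : ∀ u → Σ (Fin (nV L)) λ v → Σ (Fin (nV (Lu u))) λ w → mV (p u) v ≡ just w ×
                Σ (Fin (nE (Lu u))) λ e → (w ∈ att (Lu u) e) ×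
                  (∀ e₀ → mE (p u) e₀ ≢ just e)

-- InstBy ρ s L̄ π R̄ γ : (π : L → L̄, γ : L̄ ⇀ R̄) is obtained from (id_L, r)
-- by the steps listed in s (most recent step first), where at each step
-- the pushouts are ANY pushouts (they are only determined up to iso).

module _ {S : Signature} (ρ : UQRule S) where
  open UQRule ρ

  data InstBy : List (Fin m) → (L̄ : Graph S) → Morph L L̄ →
                (R̄ : Graph S) → Morph L̄ R̄ → Set where
    base : InstBy [] L (idM L) R r
    step : ∀ {s L̄ π R̄ γ} (u : Fin m) → InstBy s L̄ π R̄ γ →
           (L̄u : Graph S) (p' : Morph L̄ L̄u) (π' : Morph (Lu u) L̄u) →
           IsPushout π (p u) p' π' →
           (R̄u : Graph S) (σ : Morph R̄ R̄u) (τ : Morph (Ru u) R̄u) →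
           IsPushout (γ ⊚ π) (q u ⊚ p u) σ τ →
           (η : Morph L̄u R̄u) →
           (η ⊚ p') ≈ (σ ⊚ γ) → (η ⊚ π') ≈ (τ ⊚ q u) →
           (∀ (η' : Morph L̄u R̄u) → (η' ⊚ p') ≈ (σ ⊚ γ) → (η' ⊚ π') ≈ (τ ⊚ q u) → η' ≈ η) →
           InstBy (u ∷ s) L̄u (p' ⊚ π) R̄u η

count : {m : ℕ} → Fin m → List (Fin m) → ℕ
count u [] = zero
count u (x ∷ xs) with x ≟ u
... | yes _ = suc (count u xs)
... | no  _ = count u xs

module Submission where

-- An instantiation (π, γ) obtained by the steps s presents L̄ and R̄ as
-- colimits of "star" diagrams: L̄ is the colimit of the diagram consisting
-- of L together with one copy of p_u : L → L_u for every occurrence of u in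
-- s, and R̄ is the colimit of r : L ⇀ R together with one copy of
-- q_u ∘ p_u : L ⇀ R_u per occurrence; γ is the morphism induced on these
-- colimits.  The colimit depends on s only through the number of
-- occurrences of each u, so two step sequences with the same counts give
-- isomorphic colimits, and γ, being determined by its action on the legs,
-- commutes with these isomorphisms.

open import Defs
open import Data.Nat using (ℕ)
open import Data.Fin using (Fin; _≟_; zero; suc)
open import Data.List using (List; []; _∷_)
open import Data.Maybe using (Maybe; just; nothing)
open import Data.Product using (Σ; _×_; _,_; proj₁; proj₂)
open import Data.Empty using (⊥-elim)
open import Function.Bundles using (_↔_; mk↔ₛ′; Inverse)
open import Function.Properties.Inverse using (↔-sym; ↔-trans)
open import Relation.Nullary using (yes; no)
open import Relation.Binary.PropositionalEquality
  using (_≡_; refl; sym; trans; cong; subst)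

module _ {S : Signature} where

  -- Equality of morphisms, wrapped in a record so that the graphs and
  -- morphisms of an equation can be inferred from its type.
  record _≃_ {G H : Graph S} (f g : Morph G H) : Set where
    constructor mk
    field un : f ≈ g
  open _≃_ public
  infix 4 _≃_

  ≃-sym : {G H : Graph S} {f g : Morph G H} → f ≃ g → g ≃ f
  ≃-sym (mk (v≡ , e≡)) = mk ((λ v → sym (v≡ v)) , (λ e → sym (e≡ e)))

  infixr 4 _⟫_
  _⟫_ : {G H : Graph S} {f g h : Morph G H} → f ≃ g → g ≃ h → f ≃ h
  mk (v≡ , e≡) ⟫ mk (v≡' , e≡') =
    mk ((λ v → trans (v≡ v) (v≡' v)) , (λ e → trans (e≡ e) (e≡' e)))

  bind-assoc : {A B C : Set} (x : Maybe A) (g : A → Maybe B) (h : B → Maybe C) →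
               bind (bind x g) h ≡ bind x (λ a → bind (g a) h)
  bind-assoc nothing  g h = refl
  bind-assoc (just a) g h = refl

  bind-cong : {A B : Set} (x : Maybe A) {g h : A → Maybe B} →
              (∀ a → g a ≡ h a) → bind x g ≡ bind x h
  bind-cong nothing  g≡h = refl
  bind-cong (just a) g≡h = g≡h a

  bind-just : {A : Set} (x : Maybe A) → bind x just ≡ x
  bind-just nothing  = refl
  bind-just (just a) = refl

  ⊚-assoc : {G H K M : Graph S} (h : Morph K M) (g : Morph H K) (f : Morph G H) →
            (h ⊚ g) ⊚ f ≃ h ⊚ (g ⊚ f)
  ⊚-assoc h g f = mk ((λ v → sym (bind-assoc (mV f v) (mV g) (mV h))) ,
                      (λ e → sym (bind-assoc (mE f e) (mE g) (mE h))))

  ⊚-assoc⁻¹ : {G H K M : Graph S} (h : Morph K M) (g : Morph H K) (f : Morph G H) →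
              h ⊚ (g ⊚ f) ≃ (h ⊚ g) ⊚ f
  ⊚-assoc⁻¹ h g f = ≃-sym (⊚-assoc h g f)

  ⊚-congˡ : {G H K : Graph S} {g g' : Morph H K} (f : Morph G H) →
            g ≃ g' → g ⊚ f ≃ g' ⊚ f
  ⊚-congˡ f (mk (v≡ , e≡)) =
    mk ((λ v → bind-cong (mV f v) v≡) , (λ e → bind-cong (mE f e) e≡))

  ⊚-congʳ : {G H K : Graph S} (g : Morph H K) {f f' : Morph G H} →
            f ≃ f' → g ⊚ f ≃ g ⊚ f'
  ⊚-congʳ g (mk (v≡ , e≡)) =
    mk ((λ v → cong (λ x → bind x (mV g)) (v≡ v)) ,
        (λ e → cong (λ x → bind x (mE g)) (e≡ e)))

  ⊚-identityˡ : {G H : Graph S} (f : Morph G H) → idM H ⊚ f ≃ f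
  ⊚-identityˡ f = mk ((λ v → bind-just (mV f v)) , (λ e → bind-just (mE f e)))

  ⊚-identityʳ : {G H : Graph S} (f : Morph G H) → f ⊚ idM G ≃ f
  ⊚-identityʳ f = mk ((λ v → refl) , (λ e → refl))

data Occ {A : Set} : List A → A → Set where
  here  : ∀ {u s} → Occ (u ∷ s) u
  there : ∀ {x u s} → Occ s u → Occ (x ∷ s) u

module _ {m : ℕ} where

  occ→fin : (s : List (Fin m)) {u : Fin m} → Occ s u → Fin (count u s)
  occ→fin (x ∷ s) {u} o with x ≟ u
  occ→fin (x ∷ s) here      | yes refl = zero
  occ→fin (x ∷ s) (there o) | yes refl = suc (occ→fin s o)
  occ→fin (x ∷ s) here      | no x≢u   = ⊥-elim (x≢u refl)
  occ→fin (x ∷ s) (there o) | no _     = occ→fin s o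

  fin→occ : (s : List (Fin m)) {u : Fin m} → Fin (count u s) → Occ s u
  fin→occ (x ∷ s) {u} k with x ≟ u
  fin→occ (x ∷ s) zero    | yes refl = here
  fin→occ (x ∷ s) (suc k) | yes refl = there (fin→occ s k)
  ... | no _ = there (fin→occ s k)

  occ→fin→occ : (s : List (Fin m)) {u : Fin m} (k : Fin (count u s)) →
                occ→fin s (fin→occ s k) ≡ k
  occ→fin→occ (x ∷ s) {u} k with x ≟ u
  occ→fin→occ (x ∷ s) zero    | yes refl = refl
  occ→fin→occ (x ∷ s) (suc k) | yes refl = cong suc (occ→fin→occ s k)
  ... | no _ = occ→fin→occ s k

  fin→occ→fin : (s : List (Fin m)) {u : Fin m} (o : Occ s u) →
                fin→occ s (occ→fin s o) ≡ o
  fin→occ→fin (x ∷ s) {u} o with x ≟ u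
  fin→occ→fin (x ∷ s) here      | yes refl = refl
  fin→occ→fin (x ∷ s) (there o) | yes refl = cong there (fin→occ→fin s o)
  fin→occ→fin (x ∷ s) here      | no x≢u   = ⊥-elim (x≢u refl)
  fin→occ→fin (x ∷ s) (there o) | no _     = cong there (fin→occ→fin s o)

  occ↔count : (s : List (Fin m)) (u : Fin m) → Occ s u ↔ Fin (count u s)
  occ↔count s u = mk↔ₛ′ (occ→fin s) (fin→occ s) (occ→fin→occ s) (fin→occ→fin s)

  same-occurrences : (s₁ s₂ : List (Fin m)) → (∀ u → count u s₁ ≡ count u s₂) →
                     ∀ u → Occ s₁ u ↔ Occ s₂ u
  same-occurrences s₁ s₂ same u =
    ↔-trans (occ↔count s₁ u)
            (subst (λ n → Fin n ↔ Occ s₂ u) (sym (same u)) (↔-sym (occ↔count s₂ u)))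

-- Colimits of star diagrams.  The diagram has a centre L, one arm
-- f₀ : L ⇀ A₀, and, for every u : U, a family I u of copies of the arm
-- f u : L ⇀ A u.

module Star {S : Signature} {L A₀ : Graph S} (f₀ : Morph L A₀)
            {U : Set} (A : U → Graph S) (f : ∀ u → Morph L (A u)) where

  Cocone : (I : U → Set) {X : Graph S} →
           Morph A₀ X → (∀ u → I u → Morph (A u) X) → Set
  Cocone I d₀ d = ∀ u i → d₀ ⊚ f₀ ≃ d u i ⊚ f u

  Mediates : (I : U → Set) {C X : Graph S} → Morph C X →
             (c₀ : Morph A₀ C) (c : ∀ u → I u → Morph (A u) C) →
             (d₀ : Morph A₀ X) (d : ∀ u → I u → Morph (A u) X) → Set
  Mediates I θ c₀ c d₀ d = (θ ⊚ c₀ ≃ d₀) × (∀ u i → θ ⊚ c u i ≃ d u i)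

  record Colimit (I : U → Set) (C : Graph S) (c₀ : Morph A₀ C)
                 (c : ∀ u → I u → Morph (A u) C) : Set where
    field
      cocone    : Cocone I c₀ c
      universal : ∀ (X : Graph S) (d₀ : Morph A₀ X) (d : ∀ u → I u → Morph (A u) X) →
                  Cocone I d₀ d →
                  Σ (Morph C X) λ θ → Mediates I θ c₀ c d₀ d ×
                    (∀ θ' → Mediates I θ' c₀ c d₀ d → θ' ≃ θ)
  open Colimit public

  mediator-unique : ∀ {I C c₀ c} → Colimit I C c₀ c →
                    ∀ {X d₀ d} → Cocone I {X} d₀ d →
                    ∀ {θ₁ θ₂} → Mediates I θ₁ c₀ c d₀ d → Mediates I θ₂ c₀ c d₀ d →
                    θ₁ ≃ θ₂
  mediator-unique K {X} {d₀} {d} coc med₁ med₂ =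
    let (_ , _ , unique) = universal K X d₀ d coc
    in unique _ med₁ ⟫ ≃-sym (unique _ med₂)

  mediates-⊚ : ∀ {I C D E c₀ c d₀ d e₀ e} {θ : Morph C D} {ψ : Morph D E} →
               Mediates I θ c₀ c d₀ d → Mediates I ψ d₀ d e₀ e →
               Mediates I (ψ ⊚ θ) c₀ c e₀ e
  mediates-⊚ {c₀ = c₀} {c} {θ = θ} {ψ} (θc₀ , θc) (ψd₀ , ψd) =
    (⊚-assoc ψ θ c₀ ⟫ ⊚-congʳ ψ θc₀ ⟫ ψd₀) ,
    (λ u i → ⊚-assoc ψ θ (c u i) ⟫ ⊚-congʳ ψ (θc u i) ⟫ ψd u i)

  mediates-id : ∀ {I C c₀ c} → Mediates I (idM C) c₀ c c₀ c
  mediates-id {c₀ = c₀} {c} = ⊚-identityˡ c₀ , (λ u i → ⊚-identityˡ (c u i))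

  colimit-unique : ∀ {I C C' c₀ c c₀' c'} → Colimit I C c₀ c → Colimit I C' c₀' c' →
                   Σ (Morph C C') λ α → IsIso α × Mediates I α c₀ c c₀' c'
  colimit-unique {C = C} {C'} {c₀} {c} {c₀'} {c'} K K' =
    let (α , α-med , _) = universal K C' c₀' c' (cocone K')
        (β , β-med , _) = universal K' C c₀ c (cocone K)
    in α ,
       (β , un (mediator-unique K (cocone K)
                  (mediates-⊚ {c₀ = c₀} {c} {c₀'} {c'} α-med β-med) mediates-id) ,
            un (mediator-unique K' (cocone K')
                  (mediates-⊚ {c₀ = c₀'} {c'} {c₀} {c} β-med α-med) mediates-id)) ,
       α-med

  reindex : ∀ {I J : U → Set} (e : ∀ u → J u ↔ I u) → ∀ {C c₀ c} →
            Colimit I C c₀ c → Colimit J C c₀ (λ u j → c u (Inverse.to (e u) j))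
  reindex {I} {J} e {C} {c₀} {c} K = record
    { cocone    = λ u j → cocone K u (to u j)
    ; universal = λ X d₀ d coc →
        let (θ , (θc₀ , θc) , unique) =
              universal K X d₀ (λ u i → d u (from u i)) (λ u i → coc u (from u i))
        in θ ,
           (θc₀ , λ u j → subst (λ j' → θ ⊚ c u (to u j) ≃ d u j')
                                (Inverse.strictlyInverseʳ (e u) j) (θc u (to u j))) ,
           λ θ' (θ'c₀ , θ'c) → unique θ' (θ'c₀ , λ u i →
             subst (λ i' → θ' ⊚ c u i' ≃ d u (from u i))
                   (Inverse.strictlyInverseˡ (e u) i) (θ'c u (from u i))) }
    where
    to : ∀ u → J u → I u
    to u = Inverse.to (e u)
    from : ∀ u → I u → J u
    from u = Inverse.from (e u)

  empty-colimit : Colimit (Occ []) A₀ (idM A₀) (λ u ())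
  empty-colimit = record
    { cocone    = λ u ()
    ; universal = λ X d₀ d coc →
        d₀ , (⊚-identityʳ d₀ , λ u ()) ,
        λ θ' (θ'd₀ , _) → ≃-sym (⊚-identityʳ θ') ⟫ θ'd₀ }

  -- legs of the cocone after one more copy of the arm f u has been glued
  -- in by a pushout (σ, τ)
  push-legs : ∀ {s u} {C P : Graph S} (σ : Morph C P) (τ : Morph (A u) P) →
              (∀ u' → Occ s u' → Morph (A u') C) →
              ∀ u' → Occ (u ∷ s) u' → Morph (A u') P
  push-legs σ τ c _  here      = τ
  push-legs σ τ c u' (there o) = σ ⊚ c u' o

  -- Pushing out a colimit C along the map h : L ⇀ C of its centre and
  -- the arm f u yields the colimit with one more copy of f u.
  module PushoutStep {s : List U} {C : Graph S} {c₀ : Morph A₀ C}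
                     {c : ∀ u → Occ s u → Morph (A u) C} (K : Colimit (Occ s) C c₀ c)
                     (h : Morph L C) (h≃ : h ≃ c₀ ⊚ f₀)
                     (u : U) {P : Graph S} {σ : Morph C P} {τ : Morph (A u) P}
                     (PO : IsPushout h (f u) σ τ) where
    module PO = IsPushout PO

    pushed-cocone : Cocone (Occ (u ∷ s)) (σ ⊚ c₀) (push-legs σ τ c)
    pushed-cocone _ here =
      ⊚-assoc σ c₀ f₀ ⟫ ⊚-congʳ σ (≃-sym h≃) ⟫ mk PO.commute
    pushed-cocone u' (there o) =
      ⊚-assoc σ c₀ f₀ ⟫ ⊚-congʳ σ (cocone K u' o) ⟫ ⊚-assoc⁻¹ σ (c u' o) (f u')

    -- a mediator θ₁ out of C and a leg d out of A u that agree on the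
    -- centre L, as required by the pushout property
    agree-on-centre : ∀ {X d₀} {d : Morph (A u) X} {θ₁ : Morph C X} →
                      θ₁ ⊚ c₀ ≃ d₀ → d₀ ⊚ f₀ ≃ d ⊚ f u → θ₁ ⊚ h ≃ d ⊚ f u
    agree-on-centre {θ₁ = θ₁} θ₁c₀ coc =
      ⊚-congʳ θ₁ h≃ ⟫ ⊚-assoc⁻¹ θ₁ c₀ f₀ ⟫ ⊚-congˡ f₀ θ₁c₀ ⟫ coc

    -- A cocone (d₀, d) over the extended diagram restricts to one over
    -- the old diagram; its mediator θ₁ and the new leg d u here glue,
    -- by the pushout property, to the mediator θ out of P.
    pushed-universal : ∀ (X : Graph S) (d₀ : Morph A₀ X)
                       (d : ∀ u' → Occ (u ∷ s) u' → Morph (A u') X) →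
                       Cocone (Occ (u ∷ s)) d₀ d →
                       Σ (Morph P X) λ θ →
                         Mediates (Occ (u ∷ s)) θ (σ ⊚ c₀) (push-legs σ τ c) d₀ d ×
                         (∀ θ' → Mediates (Occ (u ∷ s)) θ' (σ ⊚ c₀) (push-legs σ τ c) d₀ d →
                                 θ' ≃ θ)
    pushed-universal X d₀ d coc
      with universal K X d₀ (λ u' o → d u' (there o)) (λ u' o → coc u' (there o))
    ... | θ₁ , (θ₁c₀ , θ₁c) , θ₁-unique
      with PO.universal X θ₁ (d u here) (un (agree-on-centre θ₁c₀ (coc u here)))
    ... | θ , θσ , θτ , θ-unique = θ , (θσc₀ , θlegs) , unique
      where
      θσc₀ : θ ⊚ (σ ⊚ c₀) ≃ d₀
      θσc₀ = ⊚-assoc⁻¹ θ σ c₀ ⟫ ⊚-congˡ c₀ (mk θσ) ⟫ θ₁c₀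

      θlegs : ∀ u' o → θ ⊚ push-legs σ τ c u' o ≃ d u' o
      θlegs _  here      = mk θτ
      θlegs u' (there o) = ⊚-assoc⁻¹ θ σ (c u' o) ⟫ ⊚-congˡ (c u' o) (mk θσ) ⟫ θ₁c u' o

      unique : ∀ θ' → Mediates (Occ (u ∷ s)) θ' (σ ⊚ c₀) (push-legs σ τ c) d₀ d → θ' ≃ θ
      unique θ' (θ'σc₀ , θ'legs) = mk (θ-unique θ' (un θ'σ) (un (θ'legs u here)))
        where
        -- θ' ∘ σ mediates out of the old colimit, hence equals θ₁
        θ'σ : θ' ⊚ σ ≃ θ₁
        θ'σ = θ₁-unique (θ' ⊚ σ)
                ((⊚-assoc θ' σ c₀ ⟫ θ'σc₀) ,
                 (λ u' o → ⊚-assoc θ' σ (c u' o) ⟫ θ'legs u' (there o)))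

    pushout-step : Colimit (Occ (u ∷ s)) P (σ ⊚ c₀) (push-legs σ τ c)
    pushout-step = record { cocone = pushed-cocone ; universal = pushed-universal }

  open PushoutStep public using (pushout-step)

module Instantiation {S : Signature} (ρ : UQRule S) where
  open UQRule ρ

  -- the star diagram whose colimit is L̄, and the one whose colimit is R̄
  module SL = Star (idM L) Lu p
  module SR = Star r Ru (λ u → q u ⊚ p u)

  -- (π, γ) is presented with I u copies of each u: π and the κ's form a
  -- colimit of SL, cR and the cA's a colimit of SR, and γ maps the former
  -- cocone to the image of the latter under r and the q_u.
  record Presentation (I : Fin m → Set) (L̄ : Graph S) (π : Morph L L̄)
                      (R̄ : Graph S) (γ : Morph L̄ R̄) : Set where
    field
      κ     : ∀ u → I u → Morph (Lu u) L̄
      cR    : Morph R R̄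
      cA    : ∀ u → I u → Morph (Ru u) R̄
      colL  : SL.Colimit I L̄ π κ
      colR  : SR.Colimit I R̄ cR cA
      γ-med : SL.Mediates I γ π κ (cR ⊚ r) (λ u i → cA u i ⊚ q u)
  open Presentation

  image-mediates : ∀ {I R̄₁ R̄₂ cR₁ cA₁ cR₂ cA₂} {β : Morph R̄₁ R̄₂} →
                   SR.Mediates I β cR₁ cA₁ cR₂ cA₂ →
                   SL.Mediates I β (cR₁ ⊚ r) (λ u i → cA₁ u i ⊚ q u)
                                   (cR₂ ⊚ r) (λ u i → cA₂ u i ⊚ q u)
  image-mediates {cR₁ = cR₁} {cA₁} {β = β} (βcR , βcA) =
    (⊚-assoc⁻¹ β cR₁ r ⟫ ⊚-congˡ r βcR) ,
    (λ u i → ⊚-assoc⁻¹ β (cA₁ u i) (q u) ⟫ ⊚-congˡ (q u) (βcA u i))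

  image-cocone : ∀ {I X cR cA} → SR.Cocone I {X} cR cA →
                 SL.Cocone I (cR ⊚ r) (λ u i → cA u i ⊚ q u)
  image-cocone {cR = cR} {cA} coc u i =
    ⊚-identityʳ (cR ⊚ r) ⟫ coc u i ⟫ ⊚-assoc⁻¹ (cA u i) (q u) (p u)

  presentation : ∀ {s L̄ π R̄ γ} → InstBy ρ s L̄ π R̄ γ → Presentation (Occ s) L̄ π R̄ γ
  presentation base = record
    { κ = λ u () ; cR = idM R ; cA = λ u ()
    ; colL = SL.empty-colimit ; colR = SR.empty-colimit
    ; γ-med = (⊚-identityʳ r ⟫ ≃-sym (⊚-identityˡ r)) , λ u () }
  presentation (step {s} {L̄} {π} {R̄} {γ} u inst L̄u p' π' POL R̄u σ τ POR η ηp' ηπ' _) =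
    record
      { κ = SL.push-legs p' π' IH.κ ; cR = σ ⊚ IH.cR ; cA = SR.push-legs σ τ IH.cA
      ; colL = SL.pushout-step IH.colL π (≃-sym (⊚-identityʳ π)) u POL
      ; colR = SR.pushout-step IH.colR (γ ⊚ π) γπ u POR
      ; γ-med = ηπ , ηκ }
    where
    module IH = Presentation (presentation inst)
    γπ : γ ⊚ π ≃ IH.cR ⊚ r
    γπ = proj₁ IH.γ-med

    ηπ : η ⊚ (p' ⊚ π) ≃ (σ ⊚ IH.cR) ⊚ r
    ηπ = ⊚-assoc⁻¹ η p' π ⟫ ⊚-congˡ π (mk ηp') ⟫ ⊚-assoc σ γ π ⟫
         ⊚-congʳ σ γπ ⟫ ⊚-assoc⁻¹ σ IH.cR r

    ηκ : ∀ u' o → η ⊚ SL.push-legs p' π' IH.κ u' o ≃ SR.push-legs σ τ IH.cA u' o ⊚ q u'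
    ηκ _  here      = mk ηπ'
    ηκ u' (there o) = ⊚-assoc⁻¹ η p' (IH.κ u' o) ⟫ ⊚-congˡ (IH.κ u' o) (mk ηp') ⟫
                      ⊚-assoc σ γ (IH.κ u' o) ⟫ ⊚-congʳ σ (proj₂ IH.γ-med u' o) ⟫
                      ⊚-assoc⁻¹ σ (IH.cA u' o) (q u')

  reindex-presentation : ∀ {I J : Fin m → Set} (e : ∀ u → J u ↔ I u) →
                         ∀ {L̄ π R̄ γ} → Presentation I L̄ π R̄ γ → Presentation J L̄ π R̄ γ
  reindex-presentation e P = record
    { κ = λ u j → κ P u (Inverse.to (e u) j)
    ; cR = cR P
    ; cA = λ u j → cA P u (Inverse.to (e u) j)
    ; colL = SL.reindex e (colL P)
    ; colR = SR.reindex e (colR P)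
    ; γ-med = proj₁ (γ-med P) , λ u j → proj₂ (γ-med P) u (Inverse.to (e u) j) }

  -- Two presentations with the same copies are isomorphic: α and β are
  -- the comparison isomorphisms of the colimits, and β ∘ γ₁ and γ₂ ∘ α
  -- both mediate from the colimit L̄₁ to the same cocone.
  presentations-isomorphic :
    ∀ {I L̄₁ π₁ R̄₁ γ₁ L̄₂ π₂ R̄₂ γ₂} →
    Presentation I L̄₁ π₁ R̄₁ γ₁ → Presentation I L̄₂ π₂ R̄₂ γ₂ →
    Σ (Morph L̄₁ L̄₂) λ α → Σ (Morph R̄₁ R̄₂) λ β →
      IsIso α × IsIso β × ((α ⊚ π₁) ≈ π₂) × ((β ⊚ γ₁) ≈ (γ₂ ⊚ α))
  presentations-isomorphic P₁ P₂
    with SL.colimit-unique (colL P₁) (colL P₂) | SR.colimit-unique (colR P₁) (colR P₂)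
  ... | α , α-iso , α-med | β , β-iso , β-med =
    α , β , α-iso , β-iso , un (proj₁ α-med) ,
    un (SL.mediator-unique (colL P₁) (image-cocone (SR.cocone (colR P₂)))
          (SL.mediates-⊚ (γ-med P₁) (image-mediates β-med))
          (SL.mediates-⊚ α-med (γ-med P₂)))

lemma7 : {S : Signature} (ρ : UQRule S) (f : Fin (UQRule.m ρ) → ℕ)
         (s₁ s₂ : List (Fin (UQRule.m ρ)))
         → (∀ u → count u s₁ ≡ f u) → (∀ u → count u s₂ ≡ f u)
         → {L̄₁ R̄₁ : Graph S} {π₁ : Morph (UQRule.L ρ) L̄₁} {γ₁ : Morph L̄₁ R̄₁}
         → {L̄₂ R̄₂ : Graph S} {π₂ : Morph (UQRule.L ρ) L̄₂} {γ₂ : Morph L̄₂ R̄₂}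
         → InstBy ρ s₁ L̄₁ π₁ R̄₁ γ₁ → InstBy ρ s₂ L̄₂ π₂ R̄₂ γ₂
         → Σ (Morph L̄₁ L̄₂) λ α → Σ (Morph R̄₁ R̄₂) λ β →
             IsIso α × IsIso β × ((α ⊚ π₁) ≈ π₂) × ((β ⊚ γ₁) ≈ (γ₂ ⊚ α))
lemma7 ρ f s₁ s₂ counts₁ counts₂ inst₁ inst₂ =
  presentations-isomorphic (presentation inst₁)
    (reindex-presentation (same-occurrences s₁ s₂ same-counts) (presentation inst₂))
  where
  open Instantiation ρ
  same-counts : ∀ u → count u s₁ ≡ count u s₂
  same-counts u = trans (counts₁ u) (sym (counts₂ u))
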